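{- Let $I$ be an independent set of a claw-free graph $G$, and let $C$ be an $I$-bad cycle with $I$-bipartition $[A,B]$. Then: (a) $N_i(B)=\emptyset$ for all $i\ge 3$; (b) there are no edges between vertices of $N_2(B)$ and vertices of $N_0(B)$; (c) for every $v\in V(G)$, $v\in N(B)\setminus A$ if and only if $v\in N(A)\setminus B$; (d) $N(B)\cap I=A$.
   Context: Graphs are finite and simple; claw-free means no induced $K_{1,3}$. For $S\subseteq V(G)$, $N(S)=\bigcup_{v\in S}N(v)$ and $N_i(S)=\{v\in V(G)\setminus S:|N(v)\cap S|=i\}$. A cycle $v_0,\ldots,v_k=v_0$ is $I$-bad if $|\{v_i,v_{i+1}\}\cap I|=1$ for all $i$ and $G[\{v_0,\ldots,v_{k-1}\}]$ is a cycle; its $I$-bipartition is $[V(C)\cap I, V(C)\setminus I]$. -}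

module Defs where

open import Data.Nat using (ℕ; zero; suc; _≤_; _%_)
open import Data.Nat.DivMod using (m%n<n)
open import Data.Bool using (Bool; true; false; not)
open import Data.Fin using (Fin; toℕ; fromℕ<; _≟_)
open import Data.Fin.Properties using (any?)
open import Data.Fin.Subset using (Subset; _∈_; _∉_; _∩_; ∁; ∣_∣)
open import Data.Vec using (tabulate; lookup)
open import Data.Sum using (_⊎_)
open import Data.Empty using (⊥)
open import Data.Product using (Σ; ∃; _×_; _,_)
open import Relation.Nullary using (¬_; does)
open import Relation.Binary.PropositionalEquality using (_≡_; _≢_)
open import Function using (_⇔_)
open import Function.Definitions using (Injective)

record Graph (n : ℕ) : Set where
  field
    adj   : Fin n → Fin n → Bool
    sym   : ∀ u v → adj u v ≡ adj v u
    irref : ∀ v → adj v v ≡ false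

module _ {n : ℕ} (G : Graph n) where
  open Graph G

  Adj : Fin n → Fin n → Set
  Adj u v = adj u v ≡ true

  ClawFree : Set
  ClawFree = ∀ (x a b c : Fin n) →
    Adj x a → Adj x b → Adj x c →
    a ≢ b → a ≢ c → b ≢ c →
    ¬ Adj a b → ¬ Adj a c → ¬ Adj b c → ⊥

  Independent : Subset n → Set
  Independent I = ∀ u v → u ∈ I → v ∈ I → ¬ Adj u v

  nbhd : Fin n → Subset n
  nbhd v = tabulate (adj v)

  InN : Subset n → Fin n → Set
  InN S v = ∃ λ u → u ∈ S × Adj u v

  InNi : Subset n → ℕ → Fin n → Set
  InNi S i v = v ∉ S × ∣ nbhd v ∩ S ∣ ≡ i

  nxt : {m : ℕ} → Fin (suc m) → Fin (suc m)
  nxt {m} i = fromℕ< (m%n<n (suc (toℕ i)) (suc m))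

  -- An I-bad cycle v_0, …, v_{k-1}, v_k = v_0 (k = suc m): distinct vertices,
  -- G[{v_0,…,v_{k-1}}] is a cycle (v_i ~ v_j iff they are cyclically
  -- consecutive), and every edge v_i v_{i+1} has exactly one end in I.
  record BadCycle (I : Subset n) : Set where
    field
      m      : ℕ
      len≥3  : 3 ≤ suc m
      v      : Fin (suc m) → Fin n
      inj    : Injective _≡_ _≡_ v
      induced : ∀ i j → Adj (v i) (v j) ⇔ (nxt i ≡ j ⊎ nxt j ≡ i)
      bad    : ∀ i → lookup I (v i) ≡ not (lookup I (v (nxt i)))

    VC : Subset n
    VC = tabulate λ x → does (any? λ i → v i ≟ x)

    A : Subset n
    A = VC ∩ I

    B : Subset n
    B = VC ∩ ∁ I

-- B is independent because C alternates between I and its complement.  A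
-- vertex of a claw-free graph has at most two neighbours in an independent
-- set, which gives (a), and a vertex with two neighbours in B adjacent to one
-- with none would centre a claw, which gives (b).  For (c) and (d), an
-- off-cycle neighbour y of a cycle vertex x must be adjacent to one of the two
-- cycle neighbours of x, which lie on the other side of [A, B]: otherwise x,
-- its cycle neighbours and y form a claw.
module Submission where

open import Defs
open import Data.Nat using (ℕ; _≤_)
open import Data.Bool using (false)
open import Data.Fin using (Fin)
open import Data.Fin.Subset using (Subset; _∈_; _∉_)
open import Data.Product using (_×_)
open import Relation.Nullary using (¬_)
open import Relation.Binary.PropositionalEquality using (_≡_)
open import Function using (_⇔_)

open import Data.Nat using (suc; z≤n; s≤s; _<_; _%_)
open import Data.Nat.Properties using (≤-<-trans; <⇒≱; ≮⇒≥; ≤-reflexive; n≮0; m≢1+n+m)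
open import Data.Nat.DivMod using (m<n⇒m%n≡m; n%n≡0)
open import Data.Bool using (Bool; true; not; _≟_)
open import Data.Bool.Properties using (not-involutive; ¬-not; not-¬)
open import Data.Fin using (#_; zero; suc; toℕ; fromℕ; inject₁; inject≤) renaming (_≟_ to _≟ᶠ_)
open import Data.Fin.Properties using (toℕ-fromℕ<; toℕ-fromℕ; toℕ-inject₁; toℕ<n; toℕ-injective; suc-injective; inject≤-injective; any?)
open import Data.Fin.Relation.Unary.Top using (view; ‵fromℕ; ‵inject₁)
open import Data.Fin.Subset using (inside; outside; _∩_; ∁; ∣_∣)
open import Data.Fin.Subset.Properties using (x∈p∩q⁺; x∈p∩q⁻; x∈∁p⇒x∉p; x∉p⇒x∈∁p; x∈p⇒∣p-x∣<∣p∣; _∈?_)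
open import Data.Vec using (_∷_; []; here; there; lookup)
open import Data.Vec.Properties using ([]=⇒lookup; lookup⇒[]=; lookup∘tabulate)
open import Data.Sum using (inj₁; inj₂)
open import Data.Empty using (⊥-elim)
open import Data.Product using (Σ; ∃; _,_; proj₁; proj₂)
open import Relation.Nullary using (Dec; does; yes; no; contradiction)
open import Relation.Nullary.Decidable using (dec-true)
open import Relation.Binary.PropositionalEquality using (_≢_; refl; sym; trans; cong; subst; module ≡-Reasoning)
open import Function using (_∘_; mk⇔; Equivalence)
open import Function.Definitions using (Injective)

does≡true⇒witness : ∀ {P : Set} (P? : Dec P) → does P? ≡ true → P
does≡true⇒witness (yes p) _ = p

x∈p⇒0<∣p∣ : ∀ {n} {p : Subset n} {x} → x ∈ p → 0 < ∣ p ∣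
x∈p⇒0<∣p∣ x∈p = ≤-<-trans z≤n (x∈p⇒∣p-x∣<∣p∣ x∈p)

enumerate : ∀ {n} (p : Subset n) →
  Σ (Fin ∣ p ∣ → Fin n) λ f → Injective _≡_ _≡_ f × (∀ i → f i ∈ p)
enumerate [] = (λ ()) , (λ { {()} }) , λ ()
enumerate (outside ∷ p) with enumerate p
... | f , f-inj , f∈p = suc ∘ f , f-inj ∘ suc-injective , there ∘ f∈p
enumerate (inside ∷ p) with enumerate p
... | f , f-inj , f∈p = g , g-inj , g∈p
  where
  g : Fin (suc ∣ p ∣) → Fin _
  g zero    = zero
  g (suc i) = suc (f i)
  g-inj : Injective _≡_ _≡_ g
  g-inj {zero}  {zero}  _ = refl
  g-inj {suc i} {suc j} e = cong suc (f-inj (suc-injective e))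
  g∈p : ∀ i → g i ∈ inside ∷ p
  g∈p zero    = here
  g∈p (suc i) = there (f∈p i)

members : ∀ {n k} (p : Subset n) → k ≤ ∣ p ∣ →
  Σ (Fin k → Fin n) λ f → Injective _≡_ _≡_ f × (∀ i → f i ∈ p)
members p k≤∣p∣ with enumerate p
... | f , f-inj , f∈p =
  (λ i → f (inject≤ i k≤∣p∣)) , inject≤-injective k≤∣p∣ k≤∣p∣ _ _ ∘ f-inj , λ i → f∈p _

module _ {n} (G : Graph n) where
  open Graph G using (adj)

  ∈-nbhd⁺ : ∀ {x y} → Adj G x y → y ∈ nbhd G x
  ∈-nbhd⁺ {x} {y} xy = lookup⇒[]= y (nbhd G x) (trans (lookup∘tabulate (adj x) y) xy)

  ∈-nbhd⁻ : ∀ {x y} → y ∈ nbhd G x → Adj G x y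
  ∈-nbhd⁻ {x} {y} y∈ = trans (sym (lookup∘tabulate (adj x) y)) ([]=⇒lookup y∈)

  Adj-sym : ∀ {x y} → Adj G x y → Adj G y x
  Adj-sym {x} {y} = trans (Graph.sym G y x)

  Adj? : ∀ x y → Dec (Adj G x y)
  Adj? x y = adj x y ≟ true

module _ {n} (G : Graph n) (claw-free : ClawFree G)
         {S : Subset n} (S-independent : Independent G S) where

  ∣nbhd∩independent∣≤2 : ∀ x → ∣ nbhd G x ∩ S ∣ ≤ 2
  ∣nbhd∩independent∣≤2 x = ≮⇒≥ three-neighbours⇒claw
    where
    three-neighbours⇒claw : ¬ 2 < ∣ nbhd G x ∩ S ∣
    three-neighbours⇒claw 3≤∣N∣ with members (nbhd G x ∩ S) 3≤∣N∣
    ... | y , y-inj , y∈ =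
      claw-free x (y (# 0)) (y (# 1)) (y (# 2)) (adj (# 0)) (adj (# 1)) (adj (# 2))
        ((λ ()) ∘ y-inj) ((λ ()) ∘ y-inj) ((λ ()) ∘ y-inj)
        (indep (# 0) (# 1)) (indep (# 0) (# 2)) (indep (# 1) (# 2))
      where
      adj : ∀ i → Adj G x (y i)
      adj i = ∈-nbhd⁻ G (proj₁ (x∈p∩q⁻ _ S (y∈ i)))
      indep : ∀ i j → ¬ Adj G (y i) (y j)
      indep i j = S-independent (y i) (y j) (proj₂ (x∈p∩q⁻ _ S (y∈ i))) (proj₂ (x∈p∩q⁻ _ S (y∈ j)))

  Nᵢ-empty-for-i≥3 : ∀ i → 3 ≤ i → ∀ x → ¬ InNi G S i x
  Nᵢ-empty-for-i≥3 i 3≤i x (_ , ∣N∣≡i) = <⇒≱ 3≤i (subst (_≤ 2) ∣N∣≡i (∣nbhd∩independent∣≤2 x))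

  N₂-N₀-nonadjacent : ∀ x y → InNi G S 2 x → InNi G S 0 y → ¬ Adj G x y
  N₂-N₀-nonadjacent x y (_ , ∣Nx∣≡2) (y∉S , ∣Ny∣≡0) xy
    with members (nbhd G x ∩ S) (≤-reflexive (sym ∣Nx∣≡2))
  ... | z , z-inj , z∈ =
    claw-free x (z (# 0)) (z (# 1)) y (adj (# 0)) (adj (# 1)) xy
      ((λ ()) ∘ z-inj) (≢y (# 0)) (≢y (# 1))
      (S-independent _ _ (∈S (# 0)) (∈S (# 1))) (¬adj-y (# 0)) (¬adj-y (# 1))
    where
    ∈S : ∀ i → z i ∈ S
    ∈S i = proj₂ (x∈p∩q⁻ _ S (z∈ i))
    adj : ∀ i → Adj G x (z i)
    adj i = ∈-nbhd⁻ G (proj₁ (x∈p∩q⁻ _ S (z∈ i)))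
    ≢y : ∀ i → z i ≢ y
    ≢y i refl = y∉S (∈S i)
    ¬adj-y : ∀ i → ¬ Adj G (z i) y
    ¬adj-y i zy = n≮0 (subst (0 <_) ∣Ny∣≡0 (x∈p⇒0<∣p∣ (x∈p∩q⁺ (∈-nbhd⁺ G (Adj-sym G zy) , ∈S i))))

module CyclicSuccessor {n} (G : Graph n) {m : ℕ} where

  nxt-fromℕ : nxt G (fromℕ m) ≡ zero
  nxt-fromℕ = toℕ-injective (begin
    toℕ (nxt G (fromℕ m))     ≡⟨ toℕ-fromℕ< _ ⟩
    suc (toℕ (fromℕ m)) % suc m ≡⟨ cong (λ t → suc t % suc m) (toℕ-fromℕ m) ⟩
    suc m % suc m             ≡⟨ n%n≡0 (suc m) ⟩
    0                         ∎)
    where open ≡-Reasoning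

  nxt-inject₁ : (j : Fin m) → nxt G (inject₁ j) ≡ suc j
  nxt-inject₁ j = toℕ-injective (begin
    toℕ (nxt G (inject₁ j))        ≡⟨ toℕ-fromℕ< _ ⟩
    suc (toℕ (inject₁ j)) % suc m ≡⟨ cong (λ t → suc t % suc m) (toℕ-inject₁ j) ⟩
    suc (toℕ j) % suc m           ≡⟨ m<n⇒m%n≡m (s≤s (toℕ<n j)) ⟩
    suc (toℕ j)                   ∎)
    where open ≡-Reasoning

  nxt-surjective : (i : Fin (suc m)) → ∃ λ p → nxt G p ≡ i
  nxt-surjective zero    = fromℕ m , nxt-fromℕ
  nxt-surjective (suc j) = inject₁ j , nxt-inject₁ j

  -- nxt ∘ nxt sends the last index to 1, the one before it to 0 and every
  -- other index i to i + 2.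
  nxt²≢id : 3 ≤ suc m → (i : Fin (suc m)) → nxt G (nxt G i) ≢ i
  nxt²≢id (s≤s (s≤s (s≤s z≤n))) i with view i
  ... | ‵fromℕ = λ e → contradiction (trans (sym (trans (cong (nxt G) nxt-fromℕ) (nxt-inject₁ zero))) e) λ ()
  ... | ‵inject₁ j with view j
  ...   | ‵fromℕ = λ e → contradiction (trans (sym (trans (cong (nxt G) (nxt-inject₁ j)) nxt-fromℕ)) e) λ ()
  ...   | ‵inject₁ k = λ e → m≢1+n+m (toℕ k) (sym (begin
    suc (suc (toℕ k))          ≡⟨ cong toℕ (sym (trans (cong (nxt G) (nxt-inject₁ j)) (nxt-inject₁ (suc k)))) ⟩
    toℕ (nxt G (nxt G i))      ≡⟨ cong toℕ e ⟩
    toℕ (inject₁ (inject₁ k))  ≡⟨ trans (toℕ-inject₁ (inject₁ k)) (toℕ-inject₁ k) ⟩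
    toℕ k                      ∎))
    where open ≡-Reasoning

module BadCycleProperties {n} {G : Graph n} {I : Subset n} (C : BadCycle G I) where
  open BadCycle C
  open CyclicSuccessor G {m}

  status : Fin n → Bool
  status = lookup I

  ∉I⇒status≡false : ∀ {x} → x ∉ I → status x ≡ false
  ∉I⇒status≡false {x} x∉I = ¬-not (x∉I ∘ lookup⇒[]= x I)

  status≡false⇒∉I : ∀ {x} → status x ≡ false → x ∉ I
  status≡false⇒∉I x≡false x∈I = contradiction (trans (sym x≡false) ([]=⇒lookup x∈I)) λ ()

  v∈VC : ∀ i → v i ∈ VC
  v∈VC i = lookup⇒[]= (v i) VC (trans (lookup∘tabulate _ (v i)) (dec-true (any? λ j → v j ≟ᶠ v i) (i , refl)))

  ∈VC⇒v : ∀ {x} → x ∈ VC → ∃ λ i → v i ≡ x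
  ∈VC⇒v {x} x∈VC = does≡true⇒witness (any? λ i → v i ≟ᶠ x) (trans (sym (lookup∘tabulate _ x)) ([]=⇒lookup x∈VC))

  ∈A⁺ : ∀ {x} → x ∈ VC → x ∈ I → x ∈ A
  ∈A⁺ x∈VC x∈I = x∈p∩q⁺ (x∈VC , x∈I)

  ∈A⁻ : ∀ {x} → x ∈ A → x ∈ VC × x ∈ I
  ∈A⁻ = x∈p∩q⁻ VC I

  ∈B⁺ : ∀ {x} → x ∈ VC → x ∉ I → x ∈ B
  ∈B⁺ x∈VC x∉I = x∈p∩q⁺ (x∈VC , x∉p⇒x∈∁p x∉I)

  ∈B⁻ : ∀ {x} → x ∈ B → x ∈ VC × x ∉ I
  ∈B⁻ x∈B with x∈p∩q⁻ VC (∁ I) x∈B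
  ... | x∈VC , x∈∁I = x∈VC , x∈∁p⇒x∉p x∈∁I

  ∉A∧∉B⇒∉VC : ∀ {x} → x ∉ A → x ∉ B → x ∉ VC
  ∉A∧∉B⇒∉VC {x} x∉A x∉B x∈VC with x ∈? I
  ... | yes x∈I = x∉A (∈A⁺ x∈VC x∈I)
  ... | no  x∉I = x∉B (∈B⁺ x∈VC x∉I)

  status-nxt : ∀ i → status (v (nxt G i)) ≡ not (status (v i))
  status-nxt i = trans (sym (not-involutive _)) (cong not (sym (bad i)))

  opposite-status : ∀ {x y} → x ∈ VC → y ∈ VC → Adj G x y → status y ≡ not (status x)
  opposite-status x∈VC y∈VC xy with ∈VC⇒v x∈VC | ∈VC⇒v y∈VC
  ... | i , refl | j , refl with Equivalence.to (induced i j) xy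
  ...   | inj₁ refl = status-nxt i
  ...   | inj₂ refl = trans (sym (not-involutive _)) (cong not (sym (status-nxt j)))

  same-status⇒¬Adj : ∀ {x y} → x ∈ VC → y ∈ VC → status x ≡ status y → ¬ Adj G x y
  same-status⇒¬Adj x∈VC y∈VC x≡y xy = not-¬ (sym x≡y) (opposite-status x∈VC y∈VC xy)

  B-independent : Independent G B
  B-independent x y x∈B y∈B =
    same-status⇒¬Adj (proj₁ (∈B⁻ x∈B)) (proj₁ (∈B⁻ y∈B))
      (trans (∉I⇒status≡false (proj₂ (∈B⁻ x∈B))) (sym (∉I⇒status≡false (proj₂ (∈B⁻ y∈B)))))

  B-neighbour∈A : ∀ {x y} → x ∈ B → y ∈ VC → Adj G x y → y ∈ A
  B-neighbour∈A x∈B y∈VC xy with ∈B⁻ x∈B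
  ... | x∈VC , x∉I = ∈A⁺ y∈VC (lookup⇒[]= _ I
        (trans (opposite-status x∈VC y∈VC xy) (cong not (∉I⇒status≡false x∉I))))

  A-neighbour∈B : ∀ {x y} → x ∈ A → y ∈ VC → Adj G x y → y ∈ B
  A-neighbour∈B x∈A y∈VC xy with ∈A⁻ x∈A
  ... | x∈VC , x∈I = ∈B⁺ y∈VC (status≡false⇒∉I
        (trans (opposite-status x∈VC y∈VC xy) (cong not ([]=⇒lookup x∈I))))

  cycle-neighbour : ∀ {x} → x ∈ VC → ∃ λ y → y ∈ VC × Adj G x y
  cycle-neighbour x∈VC with ∈VC⇒v x∈VC
  ... | i , refl = v (nxt G i) , v∈VC _ , Equivalence.from (induced i (nxt G i)) (inj₁ refl)

  off-cycle-neighbour : ClawFree G → ∀ {x y} → x ∈ VC → y ∉ VC → Adj G x y →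
    ∃ λ z → z ∈ VC × Adj G x z × Adj G z y
  off-cycle-neighbour claw-free {x} {y} x∈VC y∉VC xy with ∈VC⇒v x∈VC
  ... | i , refl with nxt-surjective i
  ... | p , refl = choose (Adj? G s y) (Adj? G w y)
    where
    s w : Fin n
    s = v (nxt G (nxt G p))
    w = v p
    xs : Adj G x s
    xs = Equivalence.from (induced (nxt G p) _) (inj₁ refl)
    xw : Adj G x w
    xw = Equivalence.from (induced (nxt G p) p) (inj₂ refl)
    off-cycle : ∀ j → v j ≢ y
    off-cycle j refl = y∉VC (v∈VC j)
    choose : Dec (Adj G s y) → Dec (Adj G w y) → ∃ λ z → z ∈ VC × Adj G x z × Adj G z y
    choose (yes sy) _        = s , v∈VC _ , xs , sy
    choose (no _)   (yes wy) = w , v∈VC _ , xw , wy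
    choose (no ¬sy) (no ¬wy) = ⊥-elim (claw-free x s w y xs xw xy
      (nxt²≢id len≥3 p ∘ inj) (off-cycle _) (off-cycle _)
      (same-status⇒¬Adj (v∈VC _) (v∈VC _)
        (trans (opposite-status x∈VC (v∈VC _) xs) (sym (opposite-status x∈VC (v∈VC _) xw))))
      ¬sy ¬wy)

  N[B]∖A⇔N[A]∖B : ClawFree G → Independent G I →
    ∀ x → (InN G B x × x ∉ A) ⇔ (InN G A x × x ∉ B)
  N[B]∖A⇔N[A]∖B claw-free I-independent x = mk⇔
    (cross B-independent (proj₁ ∘ ∈B⁻) B-neighbour∈A ∉A∧∉B⇒∉VC)
    (cross A-independent (proj₁ ∘ ∈A⁻) A-neighbour∈B (λ x∉B x∉A → ∉A∧∉B⇒∉VC x∉A x∉B))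
    where
    A-independent : Independent G A
    A-independent x y x∈A y∈A = I-independent x y (proj₂ (∈A⁻ x∈A)) (proj₂ (∈A⁻ y∈A))
    cross : ∀ {S T} → Independent G S → (∀ {z} → z ∈ S → z ∈ VC) →
      (∀ {z w} → z ∈ S → w ∈ VC → Adj G z w → w ∈ T) → (x ∉ T → x ∉ S → x ∉ VC) →
      InN G S x × x ∉ T → InN G T x × x ∉ S
    cross {S} S-independent S⊆VC S-neighbour∈T ∉T∧∉S⇒∉VC ((u , u∈S , ux) , x∉T) =
      let z , z∈VC , uz , zx = off-cycle-neighbour claw-free (S⊆VC u∈S) (∉T∧∉S⇒∉VC x∉T x∉S) ux
      in (z , S-neighbour∈T u∈S z∈VC uz , zx) , x∉S
      where
      x∉S : x ∉ S
      x∉S x∈S = S-independent u x u∈S x∈S ux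

  N[B]∩I⇔A : ClawFree G → Independent G I → ∀ x → (InN G B x × x ∈ I) ⇔ x ∈ A
  N[B]∩I⇔A claw-free I-independent x = mk⇔ to from
    where
    to : InN G B x × x ∈ I → x ∈ A
    to ((u , u∈B , ux) , x∈I) with x ∈? VC
    ... | yes x∈VC = ∈A⁺ x∈VC x∈I
    ... | no  x∉VC with off-cycle-neighbour claw-free (proj₁ (∈B⁻ u∈B)) x∉VC ux
    ...   | z , z∈VC , uz , zx =
      ⊥-elim (I-independent z x (proj₂ (∈A⁻ (B-neighbour∈A u∈B z∈VC uz))) x∈I zx)
    from : x ∈ A → InN G B x × x ∈ I
    from x∈A with ∈A⁻ x∈A
    ... | x∈VC , x∈I with cycle-neighbour x∈VC
    ...   | y , y∈VC , xy = (y , A-neighbour∈B x∈A y∈VC xy , Adj-sym G xy) , x∈I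

proposition21 : ∀ {n : ℕ} (G : Graph n) (I : Subset n) →
    ClawFree G → Independent G I → (C : BadCycle G I) →
    let A = BadCycle.A C
        B = BadCycle.B C
    in ((i : ℕ) → 3 ≤ i → (x : Fin n) → ¬ InNi G B i x)
     × ((x y : Fin n) → InNi G B 2 x → InNi G B 0 y → Graph.adj G x y ≡ false)
     × ((x : Fin n) → (InN G B x × x ∉ A) ⇔ (InN G A x × x ∉ B))
     × ((x : Fin n) → (InN G B x × x ∈ I) ⇔ x ∈ A)
proposition21 G I claw-free I-independent C =
    Nᵢ-empty-for-i≥3 G claw-free B-independent
  , (λ x y x∈N₂ y∈N₀ → ¬-not (N₂-N₀-nonadjacent G claw-free B-independent x y x∈N₂ y∈N₀))
  , N[B]∖A⇔N[A]∖B claw-free I-independent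
  , N[B]∩I⇔A claw-free I-independent
  where open BadCycleProperties C
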